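{- Every $[1]$-trade of volume $3$ is a shift of a trade $(\{Y_1,Y_2,Y_3\},\{Z_1,Z_2,Z_3\})$, where $Y_1,Y_2,Y_3$ are mutually disjoint, $Z_1,Z_2,Z_3$ are mutually disjoint, $Y_1\oplus Y_2\oplus Y_3=Z_1\oplus Z_2\oplus Z_3$, and $Y_i\ne Z_j$ for all $i,j\in\{1,2,3\}$.
   Context: Let $V=\{1,\dots,v\}$ and let $\oplus$ denote symmetric difference of subsets. A $[1]$-trade is a pair $T=(T_+,T_-)$ of disjoint finite multisets of subsets of $V$ (blocks) with $|T_+|=|T_-|$ such that every element of $V$ lies in the same number of blocks of $T_+$ as of $T_-$ (with multiplicity); its volume is $|T_+|$. For $Y\subseteq V$, the $Y$-shift of $T$ is the trade obtained by replacing every block $B$ (in both legs, with multiplicity) by $Y\oplus B$; a shift of $T$ is a $Y$-shift for some $Y$. -}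

module Defs where

open import Data.Nat using (ℕ)
open import Data.Bool using (_xor_)
open import Data.Vec using (zipWith)
open import Data.Fin using (Fin)
open import Data.Fin.Subset using (Subset; _∈_; _∩_; Empty)
open import Data.Fin.Subset.Properties using (_∈?_)
open import Data.List using (List; length; filter; map)
open import Data.List.Membership.Propositional as L using ()
open import Data.Product using (_×_)
open import Relation.Nullary using (¬_)
open import Relation.Binary.PropositionalEquality using (_≡_)

_⊕_ : ∀ {v} → Subset v → Subset v → Subset v
p ⊕ q = zipWith _xor_ p q

Disjoint : ∀ {v} → Subset v → Subset v → Set
Disjoint p q = Empty (p ∩ q)

-- Finite multisets of blocks are lists of subsets (equality up to permutation).
-- Number of blocks (with multiplicity) of L that contain x.
deg : ∀ {v} → Fin v → List (Subset v) → ℕ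
deg x L = length (filter (x ∈?_) L)

IsTrade : ∀ {v} → List (Subset v) → List (Subset v) → Set
IsTrade {v} T₊ T₋ =
  (∀ B → B L.∈ T₊ → ¬ (B L.∈ T₋)) ×
  (length T₊ ≡ length T₋) ×
  (∀ (x : Fin v) → deg x T₊ ≡ deg x T₋)

shift : ∀ {v} → Subset v → List (Subset v) → List (Subset v)
shift Y L = map (Y ⊕_) L

-- Shift by the pointwise majority Y of the three blocks A₁, A₂, A₃ of T₊: every point
-- then lies in at most one of the blocks Y ⊕ Aᵢ, so they are pairwise disjoint.  A shift
-- of a trade is again a trade (at points of Y it replaces each degree d by the volume
-- minus d), so the shifted T₋ has the same degrees ≤ 1 and its blocks are pairwise
-- disjoint as well.  The symmetric difference of three blocks contains exactly the
-- points of odd degree, so it is the same for both legs.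
module Submission where

open import Defs
open import Data.Nat using (ℕ; suc; _+_; _≤_; _%_; _≡ᵇ_; z≤n; s≤s)
open import Data.Nat.Properties using (+-suc; +-identityʳ; +-cancelʳ-≡; module ≤-Reasoning)
open import Data.Bool using (Bool; true; false; not; _∧_; _∨_; _xor_)
open import Data.Bool.Properties using (xor-assoc; xor-same)
open import Data.Fin using (Fin)
open import Data.Vec using (lookup; tabulate; _∷_; [])
open import Data.Vec.Properties using (lookup-zipWith; lookup∘tabulate; tabulate∘lookup; tabulate-cong; []=⇒lookup; lookup⇒[]=)
open import Data.Fin.Subset using (Subset)
open import Data.Fin.Subset.Properties using (_∈?_)
open import Data.List using (List; length; _∷_; [])
open import Data.List.Properties using (length-map)
open import Data.List.Membership.Propositional using (_∈_)
open import Data.List.Membership.Propositional.Properties using (∈-map⁻)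
open import Data.List.Relation.Unary.Any using (here; there)
open import Data.List.Relation.Binary.Permutation.Propositional using (_↭_; ↭-reflexive)
open import Data.Product using (_×_; ∃-syntax; _,_; proj₁; proj₂)
open import Relation.Nullary using (¬_; yes; no; contradiction)
open import Relation.Binary.PropositionalEquality
  using (_≡_; _≢_; refl; sym; trans; cong; cong₂; subst; module ≡-Reasoning)

private
  variable
    v : ℕ
    x : Fin v
    P Q R P′ Q′ R′ : Subset v

toℕ : Bool → ℕ
toℕ false = 0
toℕ true  = 1

count₃ : Bool → Bool → Bool → ℕ
count₃ a b c = toℕ a + (toℕ b + toℕ c)

majority : Bool → Bool → Bool → Bool
majority a b c = (a ∧ b) ∨ (b ∧ c) ∨ (c ∧ a)

xor-cancelˡ : ∀ a b → a xor (a xor b) ≡ b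
xor-cancelˡ a b = trans (sym (xor-assoc a a b)) (cong (_xor b) (xor-same a))

xor₃≡odd-count₃ : ∀ a b c → (a xor b) xor c ≡ (count₃ a b c % 2 ≡ᵇ 1)
xor₃≡odd-count₃ false false false = refl
xor₃≡odd-count₃ false false true  = refl
xor₃≡odd-count₃ false true  false = refl
xor₃≡odd-count₃ false true  true  = refl
xor₃≡odd-count₃ true  false false = refl
xor₃≡odd-count₃ true  false true  = refl
xor₃≡odd-count₃ true  true  false = refl
xor₃≡odd-count₃ true  true  true  = refl

count₃-xor-majority≤1 : ∀ a b c → let m = majority a b c in count₃ (m xor a) (m xor b) (m xor c) ≤ 1
count₃-xor-majority≤1 false false false = z≤n
count₃-xor-majority≤1 false false true  = s≤s z≤n
count₃-xor-majority≤1 false true  false = s≤s z≤n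
count₃-xor-majority≤1 false true  true  = s≤s z≤n
count₃-xor-majority≤1 true  false false = s≤s z≤n
count₃-xor-majority≤1 true  false true  = s≤s z≤n
count₃-xor-majority≤1 true  true  false = s≤s z≤n
count₃-xor-majority≤1 true  true  true  = z≤n

count₃≤1⇒pairwise-∧≡false : ∀ a b c → count₃ a b c ≤ 1 →
  (a ∧ b ≡ false) × (a ∧ c ≡ false) × (b ∧ c ≡ false)
count₃≤1⇒pairwise-∧≡false false false false _ = refl , refl , refl
count₃≤1⇒pairwise-∧≡false false false true  _ = refl , refl , refl
count₃≤1⇒pairwise-∧≡false false true  false _ = refl , refl , refl
count₃≤1⇒pairwise-∧≡false true  false false _ = refl , refl , refl
count₃≤1⇒pairwise-∧≡false false true  true  (s≤s ())
count₃≤1⇒pairwise-∧≡false true  false true  (s≤s ())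
count₃≤1⇒pairwise-∧≡false true  true  false (s≤s ())
count₃≤1⇒pairwise-∧≡false true  true  true  (s≤s ())

subset-ext : (∀ x → lookup P x ≡ lookup Q x) → P ≡ Q
subset-ext {P = P} {Q = Q} P≗Q =
  trans (sym (tabulate∘lookup P)) (trans (tabulate-cong P≗Q) (tabulate∘lookup Q))

lookup-⊕ : ∀ (P Q : Subset v) x → lookup (P ⊕ Q) x ≡ lookup P x xor lookup Q x
lookup-⊕ P Q x = lookup-zipWith _xor_ x P Q

⊕-cancelˡ : ∀ (Y P : Subset v) → Y ⊕ (Y ⊕ P) ≡ P
⊕-cancelˡ Y P = subset-ext λ x → begin
  lookup (Y ⊕ (Y ⊕ P)) x                     ≡⟨ lookup-⊕ Y (Y ⊕ P) x ⟩
  lookup Y x xor lookup (Y ⊕ P) x            ≡⟨ cong (lookup Y x xor_) (lookup-⊕ Y P x) ⟩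
  lookup Y x xor (lookup Y x xor lookup P x) ≡⟨ xor-cancelˡ (lookup Y x) (lookup P x) ⟩
  lookup P x                                 ∎
  where open ≡-Reasoning

⊕-injectiveʳ : ∀ {Y : Subset v} → Y ⊕ P ≡ Y ⊕ Q → P ≡ Q
⊕-injectiveʳ {P = P} {Q = Q} {Y = Y} eq =
  trans (sym (⊕-cancelˡ Y P)) (trans (cong (Y ⊕_) eq) (⊕-cancelˡ Y Q))

∧≡false⇒Disjoint : (∀ x → lookup P x ∧ lookup Q x ≡ false) → Disjoint P Q
∧≡false⇒Disjoint {P = P} {Q = Q} P∧Q≡false (x , x∈P∩Q) =
  contradiction (trans (sym ([]=⇒lookup x∈P∩Q)) (trans (lookup-zipWith _∧_ x P Q) (P∧Q≡false x))) λ ()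

majority-set : Subset v → Subset v → Subset v → Subset v
majority-set P Q R = tabulate λ x → majority (lookup P x) (lookup Q x) (lookup R x)

deg-∷ : ∀ x (B : Subset v) L → deg x (B ∷ L) ≡ toℕ (lookup B x) + deg x L
deg-∷ x B L with x ∈? B | lookup B x in B[x]
... | yes _   | true  = refl
... | yes x∈B | false = contradiction (trans (sym ([]=⇒lookup x∈B)) B[x]) λ ()
... | no x∉B  | true  = contradiction (lookup⇒[]= x B B[x]) x∉B
... | no _    | false = refl

deg₃ : ∀ x (P Q R : Subset v) →
  deg x (P ∷ Q ∷ R ∷ []) ≡ count₃ (lookup P x) (lookup Q x) (lookup R x)
deg₃ x P Q R = begin
  deg x (P ∷ Q ∷ R ∷ [])                                 ≡⟨ deg-∷ x P _ ⟩
  toℕ (lookup P x) + deg x (Q ∷ R ∷ [])                  ≡⟨ cong (toℕ (lookup P x) +_) (deg-∷ x Q _) ⟩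
  toℕ (lookup P x) + (toℕ (lookup Q x) + deg x (R ∷ [])) ≡⟨ cong (λ n → toℕ (lookup P x) + (toℕ (lookup Q x) + n))
                                                              (trans (deg-∷ x R []) (+-identityʳ _)) ⟩
  count₃ (lookup P x) (lookup Q x) (lookup R x)          ∎
  where open ≡-Reasoning

lookup-⊕-at : ∀ {y} (Y B : Subset v) x → lookup Y x ≡ y → lookup (Y ⊕ B) x ≡ y xor lookup B x
lookup-⊕-at Y B x Y[x] = trans (lookup-⊕ Y B x) (cong (_xor lookup B x) Y[x])

deg-shift-∉ : ∀ {Y : Subset v} → lookup Y x ≡ false → ∀ L → deg x (shift Y L) ≡ deg x L
deg-shift-∉ Y[x] [] = refl
deg-shift-∉ {x = x} {Y = Y} Y[x] (B ∷ L) = begin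
  deg x (shift Y (B ∷ L))                     ≡⟨ deg-∷ x (Y ⊕ B) _ ⟩
  toℕ (lookup (Y ⊕ B) x) + deg x (shift Y L)  ≡⟨ cong₂ _+_ (cong toℕ (lookup-⊕-at Y B x Y[x])) (deg-shift-∉ Y[x] L) ⟩
  toℕ (lookup B x) + deg x L                  ≡⟨ sym (deg-∷ x B L) ⟩
  deg x (B ∷ L)                               ∎
  where open ≡-Reasoning

toℕ-not-+ : ∀ b m n → (toℕ (not b) + m) + (toℕ b + n) ≡ suc (m + n)
toℕ-not-+ false m n = refl
toℕ-not-+ true  m n = +-suc m n

deg-shift-∈ : ∀ {Y : Subset v} → lookup Y x ≡ true → ∀ L → deg x (shift Y L) + deg x L ≡ length L
deg-shift-∈ Y[x] [] = refl
deg-shift-∈ {x = x} {Y = Y} Y[x] (B ∷ L) = begin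
  deg x (shift Y (B ∷ L)) + deg x (B ∷ L)
    ≡⟨ cong₂ _+_ (deg-∷ x (Y ⊕ B) _) (deg-∷ x B L) ⟩
  (toℕ (lookup (Y ⊕ B) x) + deg x (shift Y L)) + (toℕ (lookup B x) + deg x L)
    ≡⟨ cong (λ b → (toℕ b + deg x (shift Y L)) + _) (lookup-⊕-at Y B x Y[x]) ⟩
  (toℕ (not (lookup B x)) + deg x (shift Y L)) + (toℕ (lookup B x) + deg x L)
    ≡⟨ toℕ-not-+ (lookup B x) _ _ ⟩
  suc (deg x (shift Y L) + deg x L)
    ≡⟨ cong suc (deg-shift-∈ Y[x] L) ⟩
  length (B ∷ L) ∎
  where open ≡-Reasoning

shift-preserves-deg : ∀ {Y : Subset v} x (L M : List (Subset v)) → length L ≡ length M →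
  deg x L ≡ deg x M → deg x (shift Y L) ≡ deg x (shift Y M)
shift-preserves-deg {Y = Y} x L M |L|≡|M| degL≡degM with lookup Y x in Y[x]
... | false = trans (deg-shift-∉ Y[x] L) (trans degL≡degM (sym (deg-shift-∉ Y[x] M)))
... | true  = +-cancelʳ-≡ (deg x L) _ _ (begin
  deg x (shift Y L) + deg x L  ≡⟨ deg-shift-∈ Y[x] L ⟩
  length L                     ≡⟨ |L|≡|M| ⟩
  length M                     ≡⟨ sym (deg-shift-∈ Y[x] M) ⟩
  deg x (shift Y M) + deg x M  ≡⟨ cong (deg x (shift Y M) +_) (sym degL≡degM) ⟩
  deg x (shift Y M) + deg x L  ∎)
  where open ≡-Reasoning

lookup-⊕₃≡odd-deg : ∀ x (P Q R : Subset v) →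
  lookup ((P ⊕ Q) ⊕ R) x ≡ (deg x (P ∷ Q ∷ R ∷ []) % 2 ≡ᵇ 1)
lookup-⊕₃≡odd-deg x P Q R = begin
  lookup ((P ⊕ Q) ⊕ R) x                          ≡⟨ lookup-⊕ (P ⊕ Q) R x ⟩
  lookup (P ⊕ Q) x xor lookup R x                 ≡⟨ cong (_xor lookup R x) (lookup-⊕ P Q x) ⟩
  (lookup P x xor lookup Q x) xor lookup R x      ≡⟨ xor₃≡odd-count₃ (lookup P x) (lookup Q x) (lookup R x) ⟩
  count₃ (lookup P x) (lookup Q x) (lookup R x) % 2 ≡ᵇ 1 ≡⟨ cong (λ n → n % 2 ≡ᵇ 1) (sym (deg₃ x P Q R)) ⟩
  deg x (P ∷ Q ∷ R ∷ []) % 2 ≡ᵇ 1                 ∎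
  where open ≡-Reasoning

⊕₃-determined-by-deg : (∀ x → deg x (P ∷ Q ∷ R ∷ []) ≡ deg x (P′ ∷ Q′ ∷ R′ ∷ [])) →
  (P ⊕ Q) ⊕ R ≡ (P′ ⊕ Q′) ⊕ R′
⊕₃-determined-by-deg {P = P} {Q = Q} {R = R} {P′ = P′} {Q′ = Q′} {R′ = R′} same-deg = subset-ext λ x →
  trans (lookup-⊕₃≡odd-deg x P Q R)
        (trans (cong (λ n → n % 2 ≡ᵇ 1) (same-deg x)) (sym (lookup-⊕₃≡odd-deg x P′ Q′ R′)))

deg≤1⇒pairwise-disjoint : (∀ x → deg x (P ∷ Q ∷ R ∷ []) ≤ 1) →
  Disjoint P Q × Disjoint P R × Disjoint Q R
deg≤1⇒pairwise-disjoint {P = P} {Q = Q} {R = R} deg≤1 =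
  ∧≡false⇒Disjoint (λ x → proj₁ (pairwise x)) ,
  ∧≡false⇒Disjoint (λ x → proj₁ (proj₂ (pairwise x))) ,
  ∧≡false⇒Disjoint (λ x → proj₂ (proj₂ (pairwise x)))
  where
  pairwise : ∀ x → (lookup P x ∧ lookup Q x ≡ false) × (lookup P x ∧ lookup R x ≡ false)
                  × (lookup Q x ∧ lookup R x ≡ false)
  pairwise x = count₃≤1⇒pairwise-∧≡false (lookup P x) (lookup Q x) (lookup R x) (subst (_≤ 1) (deg₃ x P Q R) (deg≤1 x))

deg-shift-majority≤1 : ∀ (P Q R : Subset v) x →
  deg x (shift (majority-set P Q R) (P ∷ Q ∷ R ∷ [])) ≤ 1
deg-shift-majority≤1 P Q R x = begin
  deg x (shift M (P ∷ Q ∷ R ∷ []))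
    ≡⟨ deg₃ x (M ⊕ P) (M ⊕ Q) (M ⊕ R) ⟩
  count₃ (lookup (M ⊕ P) x) (lookup (M ⊕ Q) x) (lookup (M ⊕ R) x)
    ≡⟨ cong₂ _+_ (M⊕[x] P) (cong₂ _+_ (M⊕[x] Q) (M⊕[x] R)) ⟩
  count₃ (m xor lookup P x) (m xor lookup Q x) (m xor lookup R x)
    ≤⟨ count₃-xor-majority≤1 (lookup P x) (lookup Q x) (lookup R x) ⟩
  1 ∎
  where
  open ≤-Reasoning
  M : Subset _
  M = majority-set P Q R
  m : Bool
  m = majority (lookup P x) (lookup Q x) (lookup R x)
  M⊕[x] : ∀ B → toℕ (lookup (M ⊕ B) x) ≡ toℕ (m xor lookup B x)
  M⊕[x] B = cong toℕ (lookup-⊕-at M B x (lookup∘tabulate _ x))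

shift-involutive : ∀ Y (L : List (Subset v)) → shift Y (shift Y L) ≡ L
shift-involutive Y []      = refl
shift-involutive Y (B ∷ L) = cong₂ _∷_ (⊕-cancelˡ Y B) (shift-involutive Y L)

shift-preserves-IsTrade : ∀ Y {T₊ T₋ : List (Subset v)} → IsTrade T₊ T₋ → IsTrade (shift Y T₊) (shift Y T₋)
shift-preserves-IsTrade Y {T₊} {T₋} (disjoint-legs , same-volume , same-deg) =
  shifted-disjoint ,
  trans (length-map _ T₊) (trans same-volume (sym (length-map _ T₋))) ,
  λ x → shift-preserves-deg x T₊ T₋ same-volume (same-deg x)
  where
  shifted-disjoint : ∀ B → B ∈ shift Y T₊ → ¬ (B ∈ shift Y T₋)
  shifted-disjoint B B∈ B∈′ with ∈-map⁻ (Y ⊕_) B∈ | ∈-map⁻ (Y ⊕_) B∈′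
  ... | A , A∈T₊ , refl | A′ , A′∈T₋ , Y⊕A≡Y⊕A′ =
    disjoint-legs A A∈T₊ (subst (_∈ T₋) (sym (⊕-injectiveʳ Y⊕A≡Y⊕A′)) A′∈T₋)

IsTrade⇒legs-distinct : ∀ {T₊ T₋ : List (Subset v)} {B C} → IsTrade T₊ T₋ → B ∈ T₊ → C ∈ T₋ → B ≢ C
IsTrade⇒legs-distinct (disjoint-legs , _) B∈T₊ C∈T₋ refl = disjoint-legs _ B∈T₊ C∈T₋

length≡3⇒triple : ∀ {A : Set} (L : List A) → length L ≡ 3 → ∃[ a ] ∃[ b ] ∃[ c ] L ≡ a ∷ b ∷ c ∷ []
length≡3⇒triple (a ∷ b ∷ c ∷ []) refl = a , b , c , refl

theorem6p1 : ∀ (v : ℕ) (T₊ T₋ : List (Subset v)) → IsTrade T₊ T₋ → length T₊ ≡ 3 →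
  ∃[ Y ] ∃[ Y₁ ] ∃[ Y₂ ] ∃[ Y₃ ] ∃[ Z₁ ] ∃[ Z₂ ] ∃[ Z₃ ]
    ( IsTrade (Y₁ ∷ Y₂ ∷ Y₃ ∷ []) (Z₁ ∷ Z₂ ∷ Z₃ ∷ [])
    × Disjoint Y₁ Y₂ × Disjoint Y₁ Y₃ × Disjoint Y₂ Y₃
    × Disjoint Z₁ Z₂ × Disjoint Z₁ Z₃ × Disjoint Z₂ Z₃
    × (Y₁ ⊕ Y₂) ⊕ Y₃ ≡ (Z₁ ⊕ Z₂) ⊕ Z₃
    × ¬ Y₁ ≡ Z₁ × ¬ Y₁ ≡ Z₂ × ¬ Y₁ ≡ Z₃
    × ¬ Y₂ ≡ Z₁ × ¬ Y₂ ≡ Z₂ × ¬ Y₂ ≡ Z₃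
    × ¬ Y₃ ≡ Z₁ × ¬ Y₃ ≡ Z₂ × ¬ Y₃ ≡ Z₃
    × T₊ ↭ shift Y (Y₁ ∷ Y₂ ∷ Y₃ ∷ [])
    × T₋ ↭ shift Y (Z₁ ∷ Z₂ ∷ Z₃ ∷ []))
theorem6p1 v T₊ T₋ trade@(_ , same-volume , _) volume₃
  with A₁ , A₂ , A₃ , refl ← length≡3⇒triple T₊ volume₃
     | B₁ , B₂ , B₃ , refl ← length≡3⇒triple T₋ (trans (sym same-volume) volume₃) =
  let Y₁#Y₂ , Y₁#Y₃ , Y₂#Y₃ = deg≤1⇒pairwise-disjoint Y-sparse
      Z₁#Z₂ , Z₁#Z₃ , Z₂#Z₃ = deg≤1⇒pairwise-disjoint Z-sparse
  in Y , Y ⊕ A₁ , Y ⊕ A₂ , Y ⊕ A₃ , Y ⊕ B₁ , Y ⊕ B₂ , Y ⊕ B₃ ,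
     shifted , Y₁#Y₂ , Y₁#Y₃ , Y₂#Y₃ , Z₁#Z₂ , Z₁#Z₃ , Z₂#Z₃ ,
     ⊕₃-determined-by-deg (proj₂ (proj₂ shifted)) ,
     Y≢Z first first  , Y≢Z first second  , Y≢Z first third ,
     Y≢Z second first , Y≢Z second second , Y≢Z second third ,
     Y≢Z third first  , Y≢Z third second  , Y≢Z third third ,
     ↭-reflexive (sym (shift-involutive Y _)) , ↭-reflexive (sym (shift-involutive Y _))
  where
  Y : Subset v
  Y = majority-set A₁ A₂ A₃
  shifted : IsTrade (shift Y (A₁ ∷ A₂ ∷ A₃ ∷ [])) (shift Y (B₁ ∷ B₂ ∷ B₃ ∷ []))
  shifted = shift-preserves-IsTrade Y trade
  Y-sparse : ∀ x → deg x (shift Y (A₁ ∷ A₂ ∷ A₃ ∷ [])) ≤ 1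
  Y-sparse = deg-shift-majority≤1 A₁ A₂ A₃
  Z-sparse : ∀ x → deg x (shift Y (B₁ ∷ B₂ ∷ B₃ ∷ [])) ≤ 1
  Z-sparse x = subst (_≤ 1) (proj₂ (proj₂ shifted) x) (Y-sparse x)
  Y≢Z : ∀ {B C} → B ∈ shift Y (A₁ ∷ A₂ ∷ A₃ ∷ []) → C ∈ shift Y (B₁ ∷ B₂ ∷ B₃ ∷ []) → B ≢ C
  Y≢Z = IsTrade⇒legs-distinct shifted
  first : ∀ {a b c : Subset v} → a ∈ a ∷ b ∷ c ∷ []
  first = here refl
  second : ∀ {a b c : Subset v} → b ∈ a ∷ b ∷ c ∷ []
  second = there (here refl)
  third : ∀ {a b c : Subset v} → c ∈ a ∷ b ∷ c ∷ []
  third = there (there (here refl))
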